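{- For all integers $k,m$ with $0\le k\le m$ and every integer $l>0$, \[ \bigodot_{i=k}^{m}(B^{m-i}B)^2\circ(B^lB)^2 \;=\; (B^{2m-2k+l+2}B)^2\circ\bigodot_{i=k}^{m}(B^{m-i}B)^2 \] holds up to $\beta\eta$-equivalence.
   Context: $B=\lambda f.\lambda g.\lambda x.\, f\,(g\,x)$; $B$-terms are combinatory terms built from $B$ by application, compared up to $\beta\eta$-equivalence of their $\lambda$-terms. $e_1\circ e_2$ denotes $B\,e_1\,e_2$ (associative up to equivalence). $B^0B=B$, $B^{n+1}B=B\,(B^nB)$. For a $B$-term $e$, $e^2$ denotes $e\circ e$. $\bigodot_{i=k}^{n}f_i$ denotes $f_k\circ f_{k+1}\circ\cdots\circ f_n$ (the empty composition, when $k>n$, is omitted). -}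

module Defs where

open import Data.Nat using (ℕ; zero; suc; _∸_)

data Tm : Set where
  var : ℕ → Tm
  app : Tm → Tm → Tm
  lam : Tm → Tm

ext : (ℕ → ℕ) → ℕ → ℕ
ext ρ zero    = zero
ext ρ (suc n) = suc (ρ n)

rename : (ℕ → ℕ) → Tm → Tm
rename ρ (var n)   = var (ρ n)
rename ρ (app t u) = app (rename ρ t) (rename ρ u)
rename ρ (lam t)   = lam (rename (ext ρ) t)

exts : (ℕ → Tm) → ℕ → Tm
exts σ zero    = var zero
exts σ (suc n) = rename suc (σ n)

sub : (ℕ → Tm) → Tm → Tm
sub σ (var n)   = σ n
sub σ (app t u) = app (sub σ t) (sub σ u)
sub σ (lam t)   = lam (sub (exts σ) t)

sub0 : Tm → ℕ → Tm
sub0 u zero    = u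
sub0 u (suc n) = var n

_[_] : Tm → Tm → Tm
t [ u ] = sub (sub0 u) t

infix 4 _≃βη_
data _≃βη_ : Tm → Tm → Set where
  β     : ∀ t u → app (lam t) u ≃βη t [ u ]
  η     : ∀ t → lam (app (rename suc t) (var zero)) ≃βη t
  refl  : ∀ {t} → t ≃βη t
  sym   : ∀ {t u} → t ≃βη u → u ≃βη t
  trans : ∀ {t u v} → t ≃βη u → u ≃βη v → t ≃βη v
  appL  : ∀ {t t′ u} → t ≃βη t′ → app t u ≃βη app t′ u
  appR  : ∀ {t u u′} → u ≃βη u′ → app t u ≃βη app t u′
  lamC  : ∀ {t t′} → t ≃βη t′ → lam t ≃βη lam t′

data BTerm : Set where
  B   : BTerm
  _·_ : BTerm → BTerm → BTerm

infixl 9 _·_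

-- B = λf.λg.λx. f (g x)
⟦_⟧ : BTerm → Tm
⟦ B ⟧     = lam (lam (lam (app (var 2) (app (var 1) (var 0)))))
⟦ e · f ⟧ = app ⟦ e ⟧ ⟦ f ⟧

infix 4 _≈_
_≈_ : BTerm → BTerm → Set
e ≈ f = ⟦ e ⟧ ≃βη ⟦ f ⟧

infixr 8 _∘_
_∘_ : BTerm → BTerm → BTerm
e₁ ∘ e₂ = B · e₁ · e₂

B^_B : ℕ → BTerm
B^ zero B  = B
B^ suc n B = B · (B^ n B)

_² : BTerm → BTerm
e ² = e ∘ e

-- compFrom k n f = f k ∘ f (k+1) ∘ ⋯ ∘ f (k+n)   (n+1 factors)
compFrom : ℕ → ℕ → (ℕ → BTerm) → BTerm
compFrom k zero    f = f k
compFrom k (suc n) f = f k ∘ compFrom (suc k) n f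

-- ⨀_{i=k}^{m} f i  (used only when k ≤ m, so it is nonempty)
⨀ : ℕ → ℕ → (ℕ → BTerm) → BTerm
⨀ k m f = compFrom k (m ∸ k) f

{-# OPTIONS --safe #-}
-- For n < m, Bⁿ B ∘ Bᵐ B ≈ Bᵐ⁺¹ B ∘ Bⁿ B: the case n = 0 is a direct βη computation, and
-- B x ∘ B y ≈ B (x ∘ y) lowers n.  Applying this twice on each side, (Bⁿ B)² carries
-- (Bᵐ B)² past itself as (Bᵐ⁺² B)².  The composite consists of the factors (Bʲ B)² for
-- j = m − k, …, 0; pushing (Bˡ B)² leftwards through them raises its exponent by 2 at each
-- factor, and the exponent always exceeds that of the factor it is passing because l > 0.
module Submission where

open import Defs
open import Data.Nat using (ℕ; zero; suc; pred; _≤_; _<_; _+_; _*_; _∸_; s≤s)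
open import Data.Nat.Properties using (+-comm; pred[m∸n]≡m∸[1+n]; *-distribˡ-∸; m≤m+n; n≤1+n; ≤-trans)
open import Data.Nat.Tactic.RingSolver using (solve-∀)
open import Relation.Binary.Bundles using (Setoid)
import Relation.Binary.PropositionalEquality as P
open P using (_≡_; cong; cong₂)

sub-cong : ∀ {σ τ : ℕ → Tm} → (∀ n → σ n ≡ τ n) → ∀ t → sub σ t ≡ sub τ t
sub-cong h (var n)   = h n
sub-cong h (app t u) = cong₂ app (sub-cong h t) (sub-cong h u)
sub-cong {σ} {τ} h (lam t) = cong lam (sub-cong exts-cong t)
  where
  exts-cong : ∀ n → exts σ n ≡ exts τ n
  exts-cong zero    = P.refl
  exts-cong (suc n) = cong (rename suc) (h n)

sub-rename : ∀ (σ : ℕ → Tm) (ρ : ℕ → ℕ) t → sub σ (rename ρ t) ≡ sub (λ n → σ (ρ n)) t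
sub-rename σ ρ (var n)   = P.refl
sub-rename σ ρ (app t u) = cong₂ app (sub-rename σ ρ t) (sub-rename σ ρ u)
sub-rename σ ρ (lam t)   = cong lam (P.trans (sub-rename (exts σ) (ext ρ) t) (sub-cong exts-ext t))
  where
  exts-ext : ∀ n → exts σ (ext ρ n) ≡ exts (λ n → σ (ρ n)) n
  exts-ext zero    = P.refl
  exts-ext (suc n) = P.refl

sub-var : ∀ (ρ : ℕ → ℕ) t → sub (λ n → var (ρ n)) t ≡ rename ρ t
sub-var ρ (var n)   = P.refl
sub-var ρ (app t u) = cong₂ app (sub-var ρ t) (sub-var ρ u)
sub-var ρ (lam t)   = cong lam (P.trans (sub-cong exts-var t) (sub-var (ext ρ) t))
  where
  exts-var : ∀ n → exts (λ n → var (ρ n)) n ≡ var (ext ρ n)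
  exts-var zero    = P.refl
  exts-var (suc n) = P.refl

sub-id : ∀ t → sub var t ≡ t
sub-id (var n)   = P.refl
sub-id (app t u) = cong₂ app (sub-id t) (sub-id u)
sub-id (lam t)   = cong lam (P.trans (sub-cong exts-id t) (sub-id t))
  where
  exts-id : ∀ n → exts var n ≡ var n
  exts-id zero    = P.refl
  exts-id (suc n) = P.refl

sub0-rename-suc : ∀ u t → sub (sub0 u) (rename suc t) ≡ t
sub0-rename-suc u t = P.trans (sub-rename (sub0 u) suc t) (sub-id t)

exts-sub0-rename-suc² : ∀ u t → sub (exts (sub0 u)) (rename suc (rename suc t)) ≡ rename suc t
exts-sub0-rename-suc² u t = begin
  sub (exts (sub0 u)) (rename suc (rename suc t)) ≡⟨ sub-rename (exts (sub0 u)) suc (rename suc t) ⟩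
  sub (λ n → rename suc (sub0 u n)) (rename suc t) ≡⟨ sub-rename _ suc t ⟩
  sub (λ n → var (suc n)) t                        ≡⟨ sub-var suc t ⟩
  rename suc t                                     ∎
  where open P.≡-Reasoning

≡⇒≃βη : ∀ {t u} → t ≡ u → t ≃βη u
≡⇒≃βη P.refl = refl

≃βη-ext : ∀ {t t′} → app (rename suc t) (var 0) ≃βη app (rename suc t′) (var 0) → t ≃βη t′
≃βη-ext {t} {t′} p = trans (sym (η t)) (trans (lamC p) (η t′))

B-β : ∀ f g x → app (app (app ⟦ B ⟧ f) g) x ≃βη app f (app g x)
B-β f g x =
  trans (appL (appL (β _ f))) (trans (appL (β _ g)) (trans (β _ x)
    (≡⇒≃βη (cong₂ app
      (P.trans (cong (sub (sub0 x)) (exts-sub0-rename-suc² g f)) (sub0-rename-suc x f))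
      (cong (λ h → app h x) (sub0-rename-suc x g))))))

≈-setoid : Setoid _ _
≈-setoid = record
  { Carrier       = BTerm
  ; _≈_           = _≈_
  ; isEquivalence = record { refl = refl ; sym = sym ; trans = trans }
  }

open import Relation.Binary.Reasoning.Setoid ≈-setoid

∘-cong : ∀ {a a′ c c′} → a ≈ a′ → c ≈ c′ → a ∘ c ≈ a′ ∘ c′
∘-cong p q = trans (appL (appR p)) (appR q)

∘-congˡ : ∀ a {c c′} → c ≈ c′ → a ∘ c ≈ a ∘ c′
∘-congˡ a = ∘-cong {a} refl

∘-congʳ : ∀ {a a′} c → a ≈ a′ → a ∘ c ≈ a′ ∘ c
∘-congʳ c p = ∘-cong p (refl {⟦ c ⟧})

∘-assoc : ∀ x y z → (x ∘ y) ∘ z ≈ x ∘ (y ∘ z)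
∘-assoc x y z = ≃βη-ext (applied (rename suc ⟦ x ⟧) (rename suc ⟦ y ⟧) (rename suc ⟦ z ⟧) (var 0))
  where
  applied : ∀ x y z v →
    app (app (app ⟦ B ⟧ (app (app ⟦ B ⟧ x) y)) z) v ≃βη app (app (app ⟦ B ⟧ x) (app (app ⟦ B ⟧ y) z)) v
  applied x y z v =
    trans (B-β _ _ _) (trans (B-β _ _ _) (trans (appR (sym (B-β _ _ _))) (sym (B-β _ _ _))))

B·-∘-distrib : ∀ x y → B · x ∘ B · y ≈ B · (x ∘ y)
B·-∘-distrib x y =
  ≃βη-ext (≃βη-ext (applied (rename suc (rename suc ⟦ x ⟧)) (rename suc (rename suc ⟦ y ⟧)) (var 1) (var 0)))
  where
  applied : ∀ x y u v →
    app (app (app (app ⟦ B ⟧ (app ⟦ B ⟧ x)) (app ⟦ B ⟧ y)) u) v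
      ≃βη app (app (app ⟦ B ⟧ (app (app ⟦ B ⟧ x) y)) u) v
  applied x y u v =
    trans (appL (B-β _ _ _)) (trans (B-β _ _ _) (trans (appR (B-β _ _ _))
      (sym (trans (B-β _ _ _) (B-β _ _ _)))))

B-∘-B·B· : ∀ x → B ∘ B · x ≈ B · (B · x) ∘ B
B-∘-B·B· x =
  ≃βη-ext (≃βη-ext (≃βη-ext
    (applied (rename suc (rename suc (rename suc ⟦ x ⟧))) (var 2) (var 1) (var 0))))
  where
  applied : ∀ x f g v →
    app (app (app (app (app ⟦ B ⟧ ⟦ B ⟧) (app ⟦ B ⟧ x)) f) g) v
      ≃βη app (app (app (app (app ⟦ B ⟧ (app ⟦ B ⟧ (app ⟦ B ⟧ x))) ⟦ B ⟧) f) g) v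
  applied x f g v =
    trans (appL (appL (B-β _ _ _))) (trans (B-β _ _ _) (trans (B-β _ _ _)
      (sym (trans (appL (appL (B-β _ _ _))) (trans (appL (B-β _ _ _))
        (trans (B-β _ _ _) (appR (B-β _ _ _))))))))

intertwine-∘ˡ : ∀ {a b c d e} → a ∘ c ≈ d ∘ a → b ∘ d ≈ e ∘ b → (b ∘ a) ∘ c ≈ e ∘ (b ∘ a)
intertwine-∘ˡ {a} {b} {c} {d} {e} p q = begin
  (b ∘ a) ∘ c  ≈⟨ ∘-assoc b a c ⟩
  b ∘ (a ∘ c)  ≈⟨ ∘-congˡ b p ⟩
  b ∘ (d ∘ a)  ≈⟨ sym (∘-assoc b d a) ⟩
  (b ∘ d) ∘ a  ≈⟨ ∘-congʳ a q ⟩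
  (e ∘ b) ∘ a  ≈⟨ ∘-assoc e b a ⟩
  e ∘ (b ∘ a)  ∎

intertwine-∘ʳ : ∀ {a c c′ d d′} → a ∘ c ≈ d ∘ a → a ∘ c′ ≈ d′ ∘ a → a ∘ (c ∘ c′) ≈ (d ∘ d′) ∘ a
intertwine-∘ʳ {a} {c} {c′} {d} {d′} p q = begin
  a ∘ (c ∘ c′)  ≈⟨ sym (∘-assoc a c c′) ⟩
  (a ∘ c) ∘ c′  ≈⟨ ∘-congʳ c′ p ⟩
  (d ∘ a) ∘ c′  ≈⟨ ∘-assoc d a c′ ⟩
  d ∘ (a ∘ c′)  ≈⟨ ∘-congˡ d q ⟩
  d ∘ (d′ ∘ a)  ≈⟨ sym (∘-assoc d d′ a) ⟩
  (d ∘ d′) ∘ a  ∎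

intertwine-² : ∀ {a c c₁ c₂} → a ∘ c ≈ c₁ ∘ a → a ∘ c₁ ≈ c₂ ∘ a → a ² ∘ c ² ≈ c₂ ² ∘ a ²
intertwine-² p q = intertwine-∘ˡ (intertwine-∘ʳ p p) (intertwine-∘ʳ q q)

B^B-comm : ∀ n m → n < m → B^ n B ∘ B^ m B ≈ B^ suc m B ∘ B^ n B
B^B-comm zero    (suc m) _       = B-∘-B·B· (B^ m B)
B^B-comm (suc n) (suc m) (s≤s p) = begin
  B · B^ n B ∘ B · B^ m B      ≈⟨ B·-∘-distrib (B^ n B) (B^ m B) ⟩
  B · (B^ n B ∘ B^ m B)        ≈⟨ appR (B^B-comm n m p) ⟩
  B · (B^ suc m B ∘ B^ n B)    ≈⟨ sym (B·-∘-distrib (B^ suc m B) (B^ n B)) ⟩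
  B · B^ suc m B ∘ B · B^ n B  ∎

B^B²-comm : ∀ n m → n < m → (B^ n B) ² ∘ (B^ m B) ² ≈ (B^ suc (suc m) B) ² ∘ (B^ n B) ²
B^B²-comm n m p = intertwine-² (B^B-comm n m p) (B^B-comm n (suc m) (≤-trans p (n≤1+n m)))

compFrom-B^B²-comm : ∀ d k m l → m ∸ k ≡ d → 0 < l →
  compFrom k d (λ i → (B^ (m ∸ i) B) ²) ∘ (B^ l B) ²
    ≈ (B^ (2 * d + l + 2) B) ² ∘ compFrom k d (λ i → (B^ (m ∸ i) B) ²)
compFrom-B^B²-comm zero k m l m∸k≡0 0<l rewrite m∸k≡0 | +-comm l 2 =
  B^B²-comm 0 l 0<l
compFrom-B^B²-comm (suc d) k m l m∸k≡1+d 0<l rewrite m∸k≡1+d =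
  intertwine-∘ˡ
    (compFrom-B^B²-comm d (suc k) m l m∸1+k≡d 0<l)
    (P.subst (λ j → (B^ suc d B) ² ∘ (B^ L B) ² ≈ (B^ j B) ² ∘ (B^ suc d B) ²)
      (L-step d l) (B^B²-comm (suc d) L (1+d<L d l)))
  where
  L : ℕ
  L = 2 * d + l + 2
  m∸1+k≡d : m ∸ suc k ≡ d
  m∸1+k≡d = P.trans (P.sym (pred[m∸n]≡m∸[1+n] m k)) (cong pred m∸k≡1+d)
  L-expand : ∀ d l → 2 * d + l + 2 ≡ suc (suc (d + (d + l)))
  L-expand = solve-∀
  1+d<L : ∀ d l → suc d < 2 * d + l + 2
  1+d<L d l = P.subst (suc d <_) (P.sym (L-expand d l)) (s≤s (s≤s (m≤m+n d (d + l))))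
  L-step : ∀ d l → suc (suc (2 * d + l + 2)) ≡ 2 * suc d + l + 2
  L-step = solve-∀

lemma3p4 : (k m l : ℕ) → k ≤ m → 0 < l →
    (⨀ k m (λ i → (B^ (m ∸ i) B) ²)) ∘ (B^ l B) ²
      ≈ (B^ (2 * m ∸ 2 * k + l + 2) B) ² ∘ ⨀ k m (λ i → (B^ (m ∸ i) B) ²)
lemma3p4 k m l _ 0<l rewrite P.sym (*-distribˡ-∸ 2 m k) =
  compFrom-B^B²-comm (m ∸ k) k m l P.refl 0<l
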